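{- Let $r\ge 2$ and $d\ge 1$ be integers, let $e_1,\dots,e_{r-1}\ge 2$ be integers with $\sum_{j=1}^{r-1}(e_j-1)=d-1$, and let $S=\{s_1<\cdots<s_{r-1}\}$ be a set of $r-1$ integers not containing $0$. Then the number of multi-noded rooted trees on $S\cup\{0\}$ of vertex data $(1,e_1-1,\dots,e_{r-1}-1)$ is $d^{r-2}$.
   Context: Write $s_0=0$. For positive integers $f_0,\dots,f_{n}$ (here $n=r-1$), a multi-noded rooted tree on $S\cup\{0\}$ of vertex data $(f_0,f_1,\dots,f_n)$ is a pair $(T,\beta)$ where $T$ is a tree with vertex set $S\cup\{0\}$ rooted at $0$, with edge set $E$, and $\beta:E\to\mathbb{N}$ is a function such that for every edge $e$ whose parent end (the endpoint closer to the root) is $s_i$, $\beta(e)\in\{1,\dots,f_i\}$. -}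

module Defs where

open import Data.Nat using (ℕ; zero; suc; _≤_; _∸_)
open import Data.Integer as ℤ using (ℤ)
open import Data.Fin as Fin using (Fin; zero; suc)
open import Data.Product using (Σ; _×_; proj₁; proj₂)
open import Data.Vec using (Vec; lookup; allFin)
open import Data.Vec.Relation.Unary.All using (All)
open import Relation.Binary.PropositionalEquality using (_≡_)

iter : {A : Set} → ℕ → (A → A) → A → A
iter zero    g x = x
iter (suc k) g x = g (iter k g x)

-- Index 0 is the root 0 (= s₀), index (suc i)
-- is s_{i+1}.  A rooted tree on {0,s₁,…,sₙ} rooted at 0 is encoded by its
-- edge set, each edge oriented towards the root: for every non-root
-- vertex suc i the unique edge from it towards the root, recorded as
-- (parent end, β-label).  So an "edge list" is a vector indexed by
-- the non-root vertices (the child ends of the edges).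
EdgeList : ℕ → Set
EdgeList n = Vec (Fin (suc n) × ℕ) n

parentOf : {n : ℕ} → EdgeList n → Fin (suc n) → Fin (suc n)
parentOf es zero    = zero
parentOf es (suc i) = proj₁ (lookup es i)

-- The edges form a tree rooted at 0: following parents from any vertex
-- reaches the root (within n steps), i.e. the graph is connected and
-- acyclic with all edges oriented towards 0.
IsRootedTree : {n : ℕ} → EdgeList n → Set
IsRootedTree {n} es = All (λ v → iter n (parentOf es) v ≡ zero) (allFin (suc n))

LabelsOK : {n : ℕ} → (Fin (suc n) → ℕ) → EdgeList n → Set
LabelsOK f es = All (λ pb → (1 ≤ proj₂ pb) × (proj₂ pb ≤ f (proj₁ pb))) es

MNTree : (n : ℕ) → (Fin (suc n) → ℕ) → Set
MNTree n f = Σ (EdgeList n) (λ es → IsRootedTree es × LabelsOK f es)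

vertexData : {n : ℕ} → Vec ℕ n → Fin (suc n) → ℕ
vertexData e zero    = 1
vertexData e (suc i) = lookup e i ∸ 1

StrictlyIncreasing : {n : ℕ} → Vec ℤ n → Set
StrictlyIncreasing {n} S = (i j : Fin n) → i Fin.< j → lookup S i ℤ.< lookup S j

-- Prüfer's bijection, carried along with the edge labels. Deleting the least leaf of a
-- rooted tree and recording its edge (parent end and label) reduces a tree with m + 1
-- edges to one with m edges, and the last edge left always hangs from the root. The
-- deleted leaf is recovered from the rest of the code as the least non-root vertex that
-- is not a parent end there, so the code determines the tree, and every sequence of m
-- labelled edges with arbitrary parent ends, followed by a label at the root, occurs.
-- Hence there are (f₀ + ⋯ + fₙ)^(n−1) · f₀ trees of vertex data (f₀, …, fₙ); for the
-- data (1, e₁ − 1, …, eₙ − 1) the sum is d.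
module Submission where

open import Defs
open import Data.Nat using (ℕ; zero; suc; _≤_; _∸_; _^_; _*_; z≤n; s≤s)
open import Data.Nat.Properties using (n<1+n; ≤-irrelevant; m+[n∸m]≡n; *-identityʳ)
open import Data.Integer using (ℤ; 0ℤ)
open import Data.Bool using (Bool; true; false; not; _∨_; if_then_else_)
import Data.Bool.Properties as Bool
open import Data.Fin using (Fin; zero; suc; punchIn; punchOut; pinch; toℕ; fromℕ<)
open import Data.Fin.Properties
  using (_≟_; punchInᵢ≢i; punchIn-injective; punchIn-punchOut; ¬∀⟶∃¬; pigeonhole;
         suc-injective; <-irrefl; toℕ<n; toℕ-fromℕ<; fromℕ<-toℕ; +↔⊎; *↔×)
open import Data.Product using (Σ; ∃; _×_; _,_; proj₁; proj₂; map₁; map₂)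
open import Data.Product.Properties using (Σ-≡,≡→≡)
open import Data.Product.Algebra using (Σ-assoc; ×-cong)
open import Data.Product.Function.Dependent.Propositional using (Σ-↔)
open import Data.Sum using (_⊎_; inj₁; inj₂)
open import Data.Sum.Algebra using (⊎-cong)
open import Data.Vec using (Vec; []; _∷_; map; sum; lookup; tabulate; insertAt; removeAt)
open import Data.Vec.Properties
  using (insertAt-lookup; insertAt-punchIn; insertAt-removeAt; removeAt-insertAt;
         lookup-map; tabulate-∘; tabulate∘lookup)
open import Data.Vec.Relation.Unary.All as All using (All; []; _∷_)
open import Data.Vec.Relation.Unary.All.Properties using (map⁺; map⁻; tabulate⁺; tabulate⁻)
open import Data.Vec.Membership.Propositional using (_∉_)
open import Relation.Binary.PropositionalEquality
  using (_≡_; _≢_; _≗_; refl; sym; trans; cong; cong₂; subst; module ≡-Reasoning)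
open import Relation.Nullary using (¬_; Irrelevant; does; yes; no; contradiction)
open import Relation.Nullary.Decidable using (dec-true; dec-false)
open import Axiom.UniquenessOfIdentityProofs using (module Decidable⇒UIP)
open import Function using (_∘_)
open import Function.Bundles using (_↔_; mk↔ₛ′)
open import Function.Properties.Inverse using (↔-refl; ↔-sym; ↔-trans)

private
  variable
    k l m n K : ℕ

first : (Fin (suc k) → Bool) → Fin (suc k)
first {zero}  p = zero
first {suc k} p = if p zero then zero else suc (first (p ∘ suc))

first-cong : {p q : Fin (suc k) → Bool} → p ≗ q → first p ≡ first q
first-cong {zero}  p≗q = refl
first-cong {suc k} p≗q =
  cong₂ (λ b i → if b then zero else suc i) (p≗q zero) (first-cong (p≗q ∘ suc))

first-true : (p : Fin (suc k) → Bool) {i : Fin (suc k)} → p i ≡ true → p (first p) ≡ true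
first-true {zero}  p {zero} pi≡t = pi≡t
first-true {suc k} p {i}    pi≡t with p zero in p0≡b | i
... | true  | _     = p0≡b
... | false | zero  = contradiction (trans (sym p0≡b) pi≡t) λ ()
... | false | suc j = first-true (p ∘ suc) pi≡t

≟-false : {u v : Fin k} → does (u ≟ v) ≡ false → u ≢ v
≟-false {u = u} {v} h u≡v = contradiction (trans (sym h) (dec-true (u ≟ v) u≡v)) λ ()

≟-punchIn : (i : Fin (suc k)) (u v : Fin k) → does (punchIn i u ≟ punchIn i v) ≡ does (u ≟ v)
≟-punchIn i u v with u ≟ v
... | yes refl = dec-true (punchIn i u ≟ punchIn i u) refl
... | no  u≢v  = dec-false (punchIn i u ≟ punchIn i v) (u≢v ∘ punchIn-injective i u v)

pinch-punchIn : (i j : Fin (suc k)) → pinch i (punchIn (suc i) j) ≡ j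
pinch-punchIn _       zero          = refl
pinch-punchIn zero    (suc j)       = refl
pinch-punchIn (suc i) (suc zero)    = refl
pinch-punchIn (suc i) (suc (suc j)) = cong suc (pinch-punchIn i (suc j))

punchIn-pinch : (i : Fin (suc k)) {j : Fin (suc (suc k))} → j ≢ suc i → punchIn (suc i) (pinch i j) ≡ j
punchIn-pinch         _       {zero}        _     = refl
punchIn-pinch         zero    {suc zero}    j≢1+i = contradiction refl j≢1+i
punchIn-pinch         zero    {suc (suc j)} _     = refl
punchIn-pinch {suc k} (suc i) {suc j}       j≢1+i = cong suc (punchIn-pinch i (j≢1+i ∘ cong suc))

punchIn-suc≡zero : (i j : Fin (suc k)) → punchIn (suc i) j ≡ zero → j ≡ zero
punchIn-suc≡zero i zero _ = refl

iter-suc : ∀ K (g : Fin n → Fin n) v → iter (suc K) g v ≡ iter K g (g v)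
iter-suc zero    g v = refl
iter-suc (suc K) g v = cong g (iter-suc K g v)

iter-fixed : ∀ K (g : Fin n → Fin n) {v} → g v ≡ v → iter K g v ≡ v
iter-fixed zero    g gv≡v = refl
iter-fixed (suc K) g gv≡v = trans (cong g (iter-fixed K g gv≡v)) gv≡v

iter-natural : ∀ K (h : Fin m → Fin n) {g : Fin m → Fin m} {g′ : Fin n → Fin n} →
               (∀ v → h (g v) ≡ g′ (h v)) → ∀ v → h (iter K g v) ≡ iter K g′ (h v)
iter-natural zero    h             comm v = refl
iter-natural (suc K) h {g′ = g′} comm v = trans (comm _) (cong g′ (iter-natural K h comm v))

Edge : ℕ → Set
Edge k = Fin k × ℕ

relabel : (Fin k → Fin l) → Vec (Edge k) n → Vec (Edge l) n
relabel f = map (map₁ f)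

isParent : Fin k → Vec (Edge k) n → Bool
isParent u []             = false
isParent u ((v , _) ∷ es) = does (v ≟ u) ∨ isParent u es

isParent-true : {u : Fin k} (es : Vec (Edge k) n) → isParent u es ≡ true →
                ∃ λ j → proj₁ (lookup es j) ≡ u
isParent-true {u = u} ((v , _) ∷ es) h with v ≟ u
... | yes v≡u = zero , v≡u
... | no  _   with j , e ← isParent-true es h = suc j , e

isParent-∷⁻ : {u : Fin k} (e : Edge k) (es : Vec (Edge k) n) →
              isParent u (e ∷ es) ≡ false → proj₁ e ≢ u × isParent u es ≡ false
isParent-∷⁻ _ _ h = ≟-false (Bool.∨-conicalˡ _ _ h) , Bool.∨-conicalʳ _ _ h

isParent-insertAt : (u : Fin k) (es : Vec (Edge k) n) (i : Fin (suc n)) (e : Edge k) →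
                    isParent u (insertAt es i e) ≡ isParent u (e ∷ es)
isParent-insertAt u es        zero    e = refl
isParent-insertAt u (e′ ∷ es) (suc i) e = begin
  a ∨ isParent u (insertAt es i e) ≡⟨ cong (a ∨_) (isParent-insertAt u es i e) ⟩
  a ∨ (b ∨ isParent u es)          ≡⟨ Bool.∨-assoc a b _ ⟨
  (a ∨ b) ∨ isParent u es          ≡⟨ cong (_∨ isParent u es) (Bool.∨-comm a b) ⟩
  (b ∨ a) ∨ isParent u es          ≡⟨ Bool.∨-assoc b a _ ⟩
  b ∨ (a ∨ isParent u es)          ∎
  where
  open ≡-Reasoning
  a = does (proj₁ e′ ≟ u)
  b = does (proj₁ e ≟ u)

isParent-removeAt : {u : Fin k} (es : Vec (Edge k) (suc n)) (i : Fin (suc n)) →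
                    isParent u es ≡ false → isParent u (removeAt es i) ≡ false
isParent-removeAt {u = u} es i h = proj₂ (isParent-∷⁻ (lookup es i) (removeAt es i) (begin
  isParent u (lookup es i ∷ removeAt es i)              ≡⟨ isParent-insertAt u _ i (lookup es i) ⟨
  isParent u (insertAt (removeAt es i) i (lookup es i)) ≡⟨ cong (isParent u) (insertAt-removeAt es i) ⟩
  isParent u es                                         ≡⟨ h ⟩
  false                                                 ∎))
  where open ≡-Reasoning

isParent-relabel-punchIn : (i : Fin (suc k)) (u : Fin k) (es : Vec (Edge k) n) →
                           isParent (punchIn i u) (relabel (punchIn i) es) ≡ isParent u es
isParent-relabel-punchIn i u []             = refl
isParent-relabel-punchIn i u ((v , _) ∷ es) = cong₂ _∨_ (≟-punchIn i v u) (isParent-relabel-punchIn i u es)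

isParent-relabel-punchIn-self : (i : Fin (suc k)) (es : Vec (Edge k) n) →
                                isParent i (relabel (punchIn i) es) ≡ false
isParent-relabel-punchIn-self i []             = refl
isParent-relabel-punchIn-self i ((v , _) ∷ es) =
  cong₂ _∨_ (dec-false (punchIn i v ≟ i) (punchInᵢ≢i i v)) (isParent-relabel-punchIn-self i es)

isParent-relabel-punchIn-cong : (i : Fin (suc k)) (xs : Vec (Edge (suc k)) m) (ys : Vec (Edge (suc k)) n) →
  (∀ j → isParent (suc j) xs ≡ isParent (suc j) ys) →
  ∀ j → isParent (suc j) (relabel (punchIn (suc i)) xs) ≡ isParent (suc j) (relabel (punchIn (suc i)) ys)
isParent-relabel-punchIn-cong i xs ys same j with i ≟ j
... | yes refl = trans (isParent-relabel-punchIn-self (suc i) xs) (sym (isParent-relabel-punchIn-self (suc i) ys))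
... | no  i≢j  = begin
  isParent (suc j) (map up xs)                    ≡⟨ cong (λ u → isParent u (map up xs)) lift ⟨
  isParent (punchIn (suc i) (suc j′)) (map up xs) ≡⟨ isParent-relabel-punchIn (suc i) (suc j′) xs ⟩
  isParent (suc j′) xs                            ≡⟨ same j′ ⟩
  isParent (suc j′) ys                            ≡⟨ isParent-relabel-punchIn (suc i) (suc j′) ys ⟨
  isParent (punchIn (suc i) (suc j′)) (map up ys) ≡⟨ cong (λ u → isParent u (map up ys)) lift ⟩
  isParent (suc j) (map up ys)                    ∎
  where
  open ≡-Reasoning
  up = map₁ (punchIn (suc i))
  j′ = punchOut i≢j
  lift : punchIn (suc i) (suc j′) ≡ suc j
  lift = cong suc (punchIn-punchOut i≢j)

relabel-pinch-punchIn : (i : Fin (suc k)) (es : Vec (Edge (suc k)) n) →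
                        relabel (pinch i) (relabel (punchIn (suc i)) es) ≡ es
relabel-pinch-punchIn i []             = refl
relabel-pinch-punchIn i ((v , β) ∷ es) =
  cong₂ _∷_ (cong (_, β) (pinch-punchIn i v)) (relabel-pinch-punchIn i es)

relabel-punchIn-pinch : (i : Fin (suc k)) (es : Vec (Edge (suc (suc k))) n) → isParent (suc i) es ≡ false →
                        relabel (punchIn (suc i)) (relabel (pinch i) es) ≡ es
relabel-punchIn-pinch i []             h = refl
relabel-punchIn-pinch i ((v , β) ∷ es) h =
  cong₂ _∷_ (cong (_, β) (punchIn-pinch i (proj₁ fresh))) (relabel-punchIn-pinch i es (proj₂ fresh))
  where fresh = isParent-∷⁻ (v , β) es h

-- Rooted trees and their leaves

record Rooted (K : ℕ) (es : EdgeList n) : Set where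
  constructor reachesRootWithin
  field reaches-root : ∀ v → iter K (parentOf es) v ≡ zero
open Rooted

IsRootedTree⇒Rooted : {es : EdgeList n} → IsRootedTree es → Rooted n es
IsRootedTree⇒Rooted rooted = reachesRootWithin (tabulate⁻ rooted)

Rooted⇒IsRootedTree : {es : EdgeList n} → Rooted n es → IsRootedTree es
Rooted⇒IsRootedTree rooted = tabulate⁺ (reaches-root rooted)

IsRootedTree-irrelevant : {es : EdgeList n} → Irrelevant (IsRootedTree es)
IsRootedTree-irrelevant = All.irrelevant (Decidable⇒UIP.≡-irrelevant _≟_)

root-edge : {v : Fin 2} {β : ℕ} → Rooted K ((v , β) ∷ []) → v ≡ zero
root-edge {v = zero}     _      = refl
root-edge {K} {suc zero} rooted =
  contradiction (trans (sym (iter-fixed K _ refl)) (reaches-root rooted (suc zero))) λ ()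

firstLeaf : Vec (Edge (suc (suc m))) n → Fin (suc m)
firstLeaf xs = first (λ i → not (isParent (suc i) xs))

firstLeaf-nonParent : (xs : Vec (Edge (suc (suc m))) n) → ¬ (∀ i → isParent (suc i) xs ≡ true) →
                      isParent (suc (firstLeaf xs)) xs ≡ false
firstLeaf-nonParent {m} xs ¬all
  with i , ¬parent ← ¬∀⟶∃¬ (suc m) _ (λ i → isParent (suc i) xs Bool.≟ true) ¬all =
  Bool.not-injective (first-true (λ i → not (isParent (suc i) xs)) (cong not (Bool.¬-not ¬parent)))

firstLeaf-leaf : (es : EdgeList (suc m)) → Rooted K es → isParent (suc (firstLeaf es)) es ≡ false
firstLeaf-leaf {m} {K} es rooted = firstLeaf-nonParent es everyone-a-parent
  where
  -- Descend K times from vertex 1 through children; climbing K steps back ends at 1, not at the root.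
  everyone-a-parent : ¬ (∀ i → isParent (suc i) es ≡ true)
  everyone-a-parent parent = contradiction (trans (sym (climb K)) (reaches-root rooted (suc (descend K)))) λ ()
    where
    child-of : ∀ i → ∃ λ j → proj₁ (lookup es j) ≡ suc i
    child-of i = isParent-true es (parent i)
    descend : ℕ → Fin (suc m)
    descend zero    = zero
    descend (suc k) = proj₁ (child-of (descend k))
    climb : ∀ k → iter k (parentOf es) (suc (descend k)) ≡ suc zero
    climb zero    = refl
    climb (suc k) = trans (iter-suc k (parentOf es) _)
                          (trans (cong (iter k (parentOf es)) (proj₂ (child-of (descend k)))) (climb k))

firstLeaf-short : (xs : Vec (Edge (suc (suc m))) m) → isParent (suc (firstLeaf xs)) xs ≡ false
firstLeaf-short {m} xs = firstLeaf-nonParent xs λ parent →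
  let child-of : ∀ i → ∃ λ j → proj₁ (lookup xs j) ≡ suc i
      child-of i = isParent-true xs (parent i)
      i , i′ , i<i′ , same = pigeonhole (n<1+n m) (proj₁ ∘ child-of)
  in <-irrefl (suc-injective (trans (sym (proj₂ (child-of i)))
                (trans (cong (proj₁ ∘ lookup xs) same) (proj₂ (child-of i′))))) i<i′

-- graft ℓ e makes vertex suc ℓ a new leaf with edge e, renumbering the others by punchIn (suc ℓ).
graft : Fin (suc m) → Edge (suc (suc m)) → EdgeList m → EdgeList (suc m)
graft ℓ e es = insertAt (relabel (punchIn (suc ℓ)) es) ℓ e

prune : Fin (suc m) → EdgeList (suc m) → EdgeList m
prune ℓ es = relabel (pinch ℓ) (removeAt es ℓ)

prune-graft : (ℓ : Fin (suc m)) (e : Edge (suc (suc m))) (es : EdgeList m) → prune ℓ (graft ℓ e es) ≡ es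
prune-graft ℓ e es = trans (cong (relabel (pinch ℓ)) (removeAt-insertAt _ ℓ e)) (relabel-pinch-punchIn ℓ es)

graft-prune : (ℓ : Fin (suc m)) (es : EdgeList (suc m)) → isParent (suc ℓ) es ≡ false →
              graft ℓ (lookup es ℓ) (prune ℓ es) ≡ es
graft-prune ℓ es leaf = begin
  insertAt (relabel (punchIn (suc ℓ)) (prune ℓ es)) ℓ (lookup es ℓ)
    ≡⟨ cong (λ xs → insertAt xs ℓ (lookup es ℓ)) (relabel-punchIn-pinch ℓ _ (isParent-removeAt es ℓ leaf)) ⟩
  insertAt (removeAt es ℓ) ℓ (lookup es ℓ)
    ≡⟨ insertAt-removeAt es ℓ ⟩
  es ∎
  where open ≡-Reasoning

isParent-graft : (u : Fin (suc (suc m))) (ℓ : Fin (suc m)) (e : Edge (suc (suc m))) (es : EdgeList m) →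
                 isParent u (graft ℓ e es) ≡ isParent u (e ∷ relabel (punchIn (suc ℓ)) es)
isParent-graft u ℓ e es = isParent-insertAt u _ ℓ e

parentOf-graft-leaf : (ℓ : Fin (suc m)) (e : Edge (suc (suc m))) (es : EdgeList m) →
                      parentOf (graft ℓ e es) (suc ℓ) ≡ proj₁ e
parentOf-graft-leaf ℓ e es = cong proj₁ (insertAt-lookup _ ℓ e)

parentOf-graft : (ℓ : Fin (suc m)) (e : Edge (suc (suc m))) (es : EdgeList m) (v : Fin (suc m)) →
                 parentOf (graft ℓ e es) (punchIn (suc ℓ) v) ≡ punchIn (suc ℓ) (parentOf es v)
parentOf-graft ℓ e es zero    = refl
parentOf-graft ℓ e es (suc j) =
  cong proj₁ (trans (insertAt-punchIn _ ℓ e j) (lookup-map j (map₁ (punchIn (suc ℓ))) es))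

iter-graft : ∀ K (ℓ : Fin (suc m)) (e : Edge (suc (suc m))) (es : EdgeList m) (v : Fin (suc m)) →
             iter K (parentOf (graft ℓ e es)) (punchIn (suc ℓ) v) ≡ punchIn (suc ℓ) (iter K (parentOf es) v)
iter-graft K ℓ e es v = sym (iter-natural K (punchIn (suc ℓ)) (λ w → sym (parentOf-graft ℓ e es w)) v)

Rooted-graft⁻ : (ℓ : Fin (suc m)) (e : Edge (suc (suc m))) (es : EdgeList m) →
                Rooted K (graft ℓ e es) → Rooted K es
Rooted-graft⁻ {K = K} ℓ e es rooted = reachesRootWithin λ v →
  punchIn-suc≡zero ℓ _ (trans (sym (iter-graft K ℓ e es v)) (reaches-root rooted (punchIn (suc ℓ) v)))

Rooted-prune : (ℓ : Fin (suc m)) (es : EdgeList (suc m)) → isParent (suc ℓ) es ≡ false →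
               Rooted K es → Rooted K (prune ℓ es)
Rooted-prune ℓ es leaf rooted =
  Rooted-graft⁻ ℓ (lookup es ℓ) (prune ℓ es) (subst (Rooted _) (sym (graft-prune ℓ es leaf)) rooted)

reaches-root-graft : (ℓ : Fin (suc m)) (e : Edge (suc (suc m))) (es : EdgeList m) → Rooted K es →
                     ∀ v → iter K (parentOf (graft ℓ e es)) (punchIn (suc ℓ) v) ≡ zero
reaches-root-graft {K = K} ℓ e es rooted v =
  trans (iter-graft K ℓ e es v) (cong (punchIn (suc ℓ)) (reaches-root rooted v))

Rooted-graft⁺ : (ℓ : Fin (suc m)) (e : Edge (suc (suc m))) (es : EdgeList m) → proj₁ e ≢ suc ℓ →
                Rooted K es → Rooted (suc K) (graft ℓ e es)
Rooted-graft⁺ {K = K} ℓ e es e≢ℓ rooted = reachesRootWithin reaches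
  where
  open ≡-Reasoning
  p = parentOf (graft ℓ e es)
  reaches : ∀ v → iter (suc K) p v ≡ zero
  reaches v with v ≟ suc ℓ
  ... | yes refl = begin
    iter (suc K) p (suc ℓ)                         ≡⟨ iter-suc K p (suc ℓ) ⟩
    iter K p (p (suc ℓ))                           ≡⟨ cong (iter K p) (parentOf-graft-leaf ℓ e es) ⟩
    iter K p (proj₁ e)                             ≡⟨ cong (iter K p) (punchIn-pinch ℓ e≢ℓ) ⟨
    iter K p (punchIn (suc ℓ) (pinch ℓ (proj₁ e))) ≡⟨ reaches-root-graft ℓ e es rooted (pinch ℓ (proj₁ e)) ⟩
    zero                                           ∎
  ... | no v≢ℓ = cong p (begin
    iter K p v                             ≡⟨ cong (iter K p) (punchIn-pinch ℓ v≢ℓ) ⟨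
    iter K p (punchIn (suc ℓ) (pinch ℓ v)) ≡⟨ reaches-root-graft ℓ e es rooted (pinch ℓ v) ⟩
    zero                                   ∎)

-- The Prüfer bijection

-- A tree with suc m edges is coded by the m edges removed before the last one, which
-- always hangs from the root and is remembered by its label alone.
PrüferCode : ℕ → Set
PrüferCode m = Vec (Edge (suc (suc m))) m × ℕ

push : Fin (suc (suc m)) → Edge (suc (suc (suc m))) → PrüferCode m → PrüferCode (suc m)
push ℓ e c = e ∷ relabel (punchIn (suc ℓ)) (proj₁ c) , proj₂ c

encode : EdgeList (suc m) → PrüferCode m
encode {zero}  ((_ , β) ∷ []) = [] , β
encode {suc m} es = push (firstLeaf es) (lookup es (firstLeaf es)) (encode (prune (firstLeaf es) es))

decode : PrüferCode m → EdgeList (suc m)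
decode {zero}  ([] , β)    = (zero , β) ∷ []
decode {suc m} (e ∷ c , β) = graft ℓ e (decode (relabel (pinch ℓ) c , β))
  where ℓ = firstLeaf (e ∷ c)

firstLeaf-fresh : (e : Edge (suc (suc (suc m)))) (c : Vec (Edge (suc (suc (suc m)))) m) →
                  proj₁ e ≢ suc (firstLeaf (e ∷ c)) × isParent (suc (firstLeaf (e ∷ c))) c ≡ false
firstLeaf-fresh e c = isParent-∷⁻ e c (firstLeaf-short (e ∷ c))

isParent-encode : (es : EdgeList (suc m)) → Rooted K es →
                  ∀ i → isParent (suc i) (proj₁ (encode es)) ≡ isParent (suc i) es
isParent-encode {zero}  ((v , β) ∷ []) rooted i rewrite root-edge rooted = refl
isParent-encode {suc m} es             rooted i = begin
  b ∨ isParent (suc i) (relabel (punchIn (suc ℓ)) (proj₁ (encode es′)))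
    ≡⟨ cong (b ∨_) (isParent-relabel-punchIn-cong ℓ (proj₁ (encode es′)) es′ (isParent-encode es′ rooted′) i) ⟩
  isParent (suc i) (e ∷ relabel (punchIn (suc ℓ)) es′) ≡⟨ isParent-graft (suc i) ℓ e es′ ⟨
  isParent (suc i) (graft ℓ e es′)                    ≡⟨ cong (isParent (suc i)) (graft-prune ℓ es leaf) ⟩
  isParent (suc i) es                                 ∎
  where
  open ≡-Reasoning
  ℓ = firstLeaf es
  e = lookup es ℓ
  b = does (proj₁ e ≟ suc i)
  es′ = prune ℓ es
  leaf = firstLeaf-leaf es rooted
  rooted′ = Rooted-prune ℓ es leaf rooted

isParent-decode : (c : PrüferCode m) → ∀ i → isParent (suc i) (decode c) ≡ isParent (suc i) (proj₁ c)
isParent-decode {zero}  ([] , β)    i = refl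
isParent-decode {suc m} (e ∷ c , β) i = begin
  isParent (suc i) (graft ℓ e t′)
    ≡⟨ isParent-graft (suc i) ℓ e t′ ⟩
  b ∨ isParent (suc i) (relabel (punchIn (suc ℓ)) t′)
    ≡⟨ cong (b ∨_) (isParent-relabel-punchIn-cong ℓ t′ c′ (isParent-decode (c′ , β)) i) ⟩
  b ∨ isParent (suc i) (relabel (punchIn (suc ℓ)) c′)
    ≡⟨ cong (λ xs → b ∨ isParent (suc i) xs) (relabel-punchIn-pinch ℓ c (proj₂ (firstLeaf-fresh e c))) ⟩
  b ∨ isParent (suc i) c
    ∎
  where
  open ≡-Reasoning
  ℓ = firstLeaf (e ∷ c)
  b = does (proj₁ e ≟ suc i)
  c′ = relabel (pinch ℓ) c
  t′ = decode (c′ , β)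

decode-rooted : (c : PrüferCode m) → Rooted (suc m) (decode c)
decode-rooted {zero}  ([] , β)    = reachesRootWithin λ { zero → refl ; (suc zero) → refl }
decode-rooted {suc m} (e ∷ c , β) =
  Rooted-graft⁺ ℓ e _ (proj₁ (firstLeaf-fresh e c)) (decode-rooted (relabel (pinch ℓ) c , β))
  where ℓ = firstLeaf (e ∷ c)

decode-encode : (es : EdgeList (suc m)) → Rooted K es → decode (encode es) ≡ es
decode-encode {zero}  ((v , β) ∷ []) rooted = cong (λ u → (u , β) ∷ []) (sym (root-edge rooted))
decode-encode {suc m} es             rooted = begin
  decode (encode es)
    ≡⟨ cong (λ l → graft l e (decode (relabel (pinch l) (up (proj₁ c′)) , proj₂ c′))) same-leaf ⟩
  graft ℓ e (decode (relabel (pinch ℓ) (up (proj₁ c′)) , proj₂ c′))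
    ≡⟨ cong (λ xs → graft ℓ e (decode (xs , proj₂ c′))) (relabel-pinch-punchIn ℓ (proj₁ c′)) ⟩
  graft ℓ e (decode c′)
    ≡⟨ cong (graft ℓ e) (decode-encode es′ (Rooted-prune ℓ es leaf rooted)) ⟩
  graft ℓ e es′
    ≡⟨ graft-prune ℓ es leaf ⟩
  es ∎
  where
  open ≡-Reasoning
  ℓ = firstLeaf es
  e = lookup es ℓ
  es′ = prune ℓ es
  c′ = encode es′
  up = relabel (punchIn (suc ℓ))
  leaf = firstLeaf-leaf es rooted
  same-leaf : firstLeaf (proj₁ (encode es)) ≡ ℓ
  same-leaf = first-cong (cong not ∘ isParent-encode es rooted)

encode-decode : (c : PrüferCode m) → encode (decode c) ≡ c
encode-decode {zero}  ([] , β)    = refl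
encode-decode {suc m} (e ∷ c , β) = begin
  encode t
    ≡⟨ cong (λ l → push l (lookup t l) (encode (prune l t))) same-leaf ⟩
  push ℓ (lookup t ℓ) (encode (prune ℓ t))
    ≡⟨ cong₂ (λ e′ t″ → push ℓ e′ (encode t″)) (insertAt-lookup _ ℓ e) (prune-graft ℓ e t′) ⟩
  push ℓ e (encode t′)
    ≡⟨ cong (push ℓ e) (encode-decode (c′ , β)) ⟩
  (e ∷ relabel (punchIn (suc ℓ)) c′ , β)
    ≡⟨ cong (λ xs → e ∷ xs , β) (relabel-punchIn-pinch ℓ c (proj₂ (firstLeaf-fresh e c))) ⟩
  (e ∷ c , β) ∎
  where
  open ≡-Reasoning
  ℓ = firstLeaf (e ∷ c)
  c′ = relabel (pinch ℓ) c
  t′ = decode (c′ , β)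
  t = graft ℓ e t′
  same-leaf : firstLeaf t ≡ ℓ
  same-leaf = first-cong (cong not ∘ isParent-decode (e ∷ c , β))

RootedTree : ℕ → Set
RootedTree n = Σ (EdgeList n) IsRootedTree

prüfer : RootedTree (suc m) ↔ PrüferCode m
prüfer = mk↔ₛ′ (encode ∘ proj₁) (λ c → decode c , Rooted⇒IsRootedTree (decode-rooted c)) encode-decode
  λ (es , rooted) → Σ-≡,≡→≡ (decode-encode es (IsRootedTree⇒Rooted rooted) , IsRootedTree-irrelevant _ _)

All-insertAt⁺ : {A : Set} {P : A → Set} {xs : Vec A n} (i : Fin (suc n)) {x : A} →
                P x → All P xs → All P (insertAt xs i x)
All-insertAt⁺ zero    px pxs        = px ∷ pxs
All-insertAt⁺ (suc i) px (py ∷ pxs) = py ∷ All-insertAt⁺ i px pxs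

All-insertAt⁻ : {A : Set} {P : A → Set} (xs : Vec A n) (i : Fin (suc n)) {x : A} →
                All P (insertAt xs i x) → P x × All P xs
All-insertAt⁻ xs       zero    (px ∷ pxs) = px , pxs
All-insertAt⁻ (y ∷ xs) (suc i) (py ∷ pxs) = map₂ (py ∷_) (All-insertAt⁻ xs i pxs)

encode-All : (P : Edge (suc (suc m)) → Set) (es : EdgeList (suc m)) → Rooted K es → All P es →
             All P (proj₁ (encode es)) × P (zero , proj₂ (encode es))
encode-All {zero}  P ((v , β) ∷ []) rooted (pe ∷ []) = [] , subst (λ u → P (u , β)) (root-edge rooted) pe
encode-All {suc m} P es             rooted pes       = proj₁ split ∷ map⁺ (proj₁ ih) , proj₂ ih
  where
  ℓ = firstLeaf es
  leaf = firstLeaf-leaf es rooted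
  split = All-insertAt⁻ _ ℓ (subst (All P) (sym (graft-prune ℓ es leaf)) pes)
  ih = encode-All (P ∘ map₁ (punchIn (suc ℓ))) (prune ℓ es) (Rooted-prune ℓ es leaf rooted)
                  (map⁻ (proj₂ split))

decode-All : (P : Edge (suc (suc m)) → Set) (c : PrüferCode m) → All P (proj₁ c) → P (zero , proj₂ c) →
             All P (decode c)
decode-All {zero}  P ([] , β)    []        pβ = pβ ∷ []
decode-All {suc m} P (e ∷ c , β) (pe ∷ pc) pβ =
  All-insertAt⁺ ℓ pe (map⁺ (decode-All (P ∘ map₁ (punchIn (suc ℓ))) _ (map⁻ pc′) pβ))
  where
  ℓ = firstLeaf (e ∷ c)
  pc′ = subst (All P) (sym (relabel-punchIn-pinch ℓ c (proj₂ (firstLeaf-fresh e c)))) pc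

-- Counting

Irrelevant-⇔⇒↔ : {A B : Set} → Irrelevant A → Irrelevant B → (A → B) → (B → A) → A ↔ B
Irrelevant-⇔⇒↔ irrA irrB to from = mk↔ₛ′ to from (λ _ → irrB _ _) (λ _ → irrA _ _)

label↔Fin : ∀ n → Σ ℕ (λ β → 1 ≤ β × β ≤ n) ↔ Fin n
label↔Fin n = mk↔ₛ′ to from to∘from from∘to
  where
  to : Σ ℕ (λ β → 1 ≤ β × β ≤ n) → Fin n
  to (suc β , _ , 1+β≤n) = fromℕ< 1+β≤n
  from : Fin n → Σ ℕ (λ β → 1 ≤ β × β ≤ n)
  from i = suc (toℕ i) , s≤s z≤n , toℕ<n i
  to∘from : ∀ i → to (from i) ≡ i
  to∘from i = fromℕ<-toℕ i (toℕ<n i)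
  from∘to : ∀ b → from (to b) ≡ b
  from∘to (suc β , _ , 1+β≤n) =
    Σ-≡,≡→≡ (cong suc (toℕ-fromℕ< 1+β≤n) , cong₂ _,_ (≤-irrelevant _ _) (≤-irrelevant _ _))

Σ-Fin↔Fin-sum : (g : Fin k → ℕ) → Σ (Fin k) (Fin ∘ g) ↔ Fin (sum (tabulate g))
Σ-Fin↔Fin-sum {zero}  g = mk↔ₛ′ (λ ()) (λ ()) (λ ()) (λ ())
Σ-Fin↔Fin-sum {suc k} g =
  ↔-trans Σ-split (↔-trans (⊎-cong ↔-refl (Σ-Fin↔Fin-sum (g ∘ suc))) (↔-sym +↔⊎))
  where
  Σ-split : Σ (Fin (suc k)) (Fin ∘ g) ↔ (Fin (g zero) ⊎ Σ (Fin k) (Fin ∘ g ∘ suc))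
  Σ-split = mk↔ₛ′ (λ { (zero , x) → inj₁ x ; (suc i , x) → inj₂ (i , x) })
                  (λ { (inj₁ x) → zero , x ; (inj₂ (i , x)) → suc i , x })
                  (λ { (inj₁ x) → refl ; (inj₂ (i , x)) → refl })
                  (λ { (zero , x) → refl ; (suc i , x) → refl })

Σ-All↔Fin-^ : {A : Set} {P : A → Set} → Σ A P ↔ Fin k → ∀ m → Σ (Vec A m) (All P) ↔ Fin (k ^ m)
Σ-All↔Fin-^ _ zero = mk↔ₛ′ (λ _ → zero) (λ _ → [] , []) (λ { zero → refl }) (λ { ([] , []) → refl })
Σ-All↔Fin-^ {A = A} {P} A↔k (suc m) =
  ↔-trans uncons (↔-trans (×-cong A↔k (Σ-All↔Fin-^ A↔k m)) (↔-sym *↔×))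
  where
  uncons : Σ (Vec A (suc m)) (All P) ↔ (Σ A P × Σ (Vec A m) (All P))
  uncons = mk↔ₛ′ (λ { (x ∷ xs , px ∷ pxs) → (x , px) , (xs , pxs) })
                 (λ { ((x , px) , (xs , pxs)) → x ∷ xs , px ∷ pxs })
                 (λ _ → refl)
                 (λ { (x ∷ xs , px ∷ pxs) → refl })

LabelOK : (Fin k → ℕ) → Edge k → Set
LabelOK f e = (1 ≤ proj₂ e) × (proj₂ e ≤ f (proj₁ e))

LabelOK-irrelevant : (f : Fin k → ℕ) (e : Edge k) → Irrelevant (LabelOK f e)
LabelOK-irrelevant f e (p , q) (p′ , q′) = cong₂ _,_ (≤-irrelevant p p′) (≤-irrelevant q q′)

CodeLabelsOK : (Fin (suc (suc m)) → ℕ) → PrüferCode m → Set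
CodeLabelsOK f c = All (LabelOK f) (proj₁ c) × LabelOK f (zero , proj₂ c)

LabelsOK↔CodeLabelsOK : (f : Fin (suc (suc m)) → ℕ) (t : RootedTree (suc m)) →
                        LabelsOK f (proj₁ t) ↔ CodeLabelsOK f (encode (proj₁ t))
LabelsOK↔CodeLabelsOK f (es , rooted) =
  Irrelevant-⇔⇒↔ (All.irrelevant (LabelOK-irrelevant f _)) code-irrelevant
    (encode-All (LabelOK f) es (IsRootedTree⇒Rooted rooted))
    λ (ok , ok₀) → subst (LabelsOK f) (decode-encode es (IsRootedTree⇒Rooted rooted))
                         (decode-All (LabelOK f) (encode es) ok ok₀)
  where
  code-irrelevant : Irrelevant (CodeLabelsOK f (encode es))
  code-irrelevant (p , q) (p′ , q′) =
    cong₂ _,_ (All.irrelevant (LabelOK-irrelevant f _) p p′) (LabelOK-irrelevant f _ q q′)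

labelledCode↔Fin : (f : Fin (suc (suc m)) → ℕ) →
                   Σ (PrüferCode m) (CodeLabelsOK f) ↔ Fin (sum (tabulate f) ^ m * f zero)
labelledCode↔Fin {m} f =
  ↔-trans regroup (↔-trans (×-cong (Σ-All↔Fin-^ labelledEdge↔Fin m) (label↔Fin (f zero))) (↔-sym *↔×))
  where
  labelledEdge↔Fin : Σ (Edge (suc (suc m))) (LabelOK f) ↔ Fin (sum (tabulate f))
  labelledEdge↔Fin = ↔-trans Σ-assoc (↔-trans (Σ-↔ ↔-refl (label↔Fin (f _))) (Σ-Fin↔Fin-sum f))
  regroup : Σ (PrüferCode m) (CodeLabelsOK f) ↔
            (Σ (Vec (Edge (suc (suc m))) m) (All (LabelOK f)) × Σ ℕ (λ β → LabelOK f (zero , β)))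
  regroup = mk↔ₛ′ (λ ((c , β) , (ok , ok₀)) → (c , ok) , (β , ok₀))
                  (λ ((c , ok) , (β , ok₀)) → (c , β) , (ok , ok₀))
                  (λ _ → refl) (λ _ → refl)

MNTree↔Fin : (f : Fin (suc (suc m)) → ℕ) → MNTree (suc m) f ↔ Fin (sum (tabulate f) ^ m * f zero)
MNTree↔Fin f =
  ↔-trans (↔-sym Σ-assoc) (↔-trans (Σ-↔ prüfer λ {t} → LabelsOK↔CodeLabelsOK f t) (labelledCode↔Fin f))

sum-vertexData : (e : Vec ℕ n) → sum (tabulate (vertexData e)) ≡ suc (sum (map (_∸ 1) e))
sum-vertexData e =
  cong (suc ∘ sum) (trans (tabulate-∘ (_∸ 1) (lookup e)) (cong (map (_∸ 1)) (tabulate∘lookup e)))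

corollary2p7 : (r d : ℕ) → 2 ≤ r → 1 ≤ d →
    (e : Vec ℕ (r ∸ 1)) → All (2 ≤_) e → sum (map (λ x → x ∸ 1) e) ≡ d ∸ 1 →
    (S : Vec ℤ (r ∸ 1)) → StrictlyIncreasing S → 0ℤ ∉ S →
    MNTree (r ∸ 1) (vertexData e) ↔ Fin (d ^ (r ∸ 2))
corollary2p7 (suc zero)    _ (s≤s ()) _ _ _ _ _ _ _
corollary2p7 (suc (suc m)) d _ 1≤d e _ Σe≡d-1 _ _ _ =
  subst (λ k → MNTree (suc m) (vertexData e) ↔ Fin k) count (MNTree↔Fin (vertexData e))
  where
  open ≡-Reasoning
  count : sum (tabulate (vertexData e)) ^ m * 1 ≡ d ^ m
  count = begin
    sum (tabulate (vertexData e)) ^ m * 1 ≡⟨ *-identityʳ _ ⟩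
    sum (tabulate (vertexData e)) ^ m     ≡⟨ cong (_^ m) (sum-vertexData e) ⟩
    suc (sum (map (_∸ 1) e)) ^ m          ≡⟨ cong (λ s → suc s ^ m) Σe≡d-1 ⟩
    suc (d ∸ 1) ^ m                       ≡⟨ cong (_^ m) (m+[n∸m]≡n 1≤d) ⟩
    d ^ m                                 ∎
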